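{- Let $G$ be a connected graph of order $n\ge 2$ and let $r\ge 1$ be an integer. Then: (1) $G_{SR}\cong K_{1,r}$ if and only if $G\cong P_n$ and $r=1$; (2) there is no connected graph $G$ with $G_{SR}\cong K_{2,r}$.
   Context: All graphs are finite, simple and undirected; $d_G$ is the distance in $G$. A vertex $u$ is maximally distant from $v$ if $d_G(v,w)\le d_G(u,v)$ for every neighbor $w$ of $u$. Vertices $u,v$ are mutually maximally distant (MMD) if each is maximally distant from the other. The boundary $\partial(G)$ is the set of vertices maximally distant from some vertex of $G$. The strong resolving graph $G_{SR}$ has vertex set $\partial(G)$, two vertices being adjacent iff they are MMD in $G$. $K_{s,t}$ is the complete bipartite graph with parts of sizes $s,t$; $P_n$ is the path on $n$ vertices. -}

module Defs where

open import Data.Nat using (ℕ; zero; suc; _+_; _≤_; _<_; _<ᵇ_; _≡ᵇ_)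
open import Data.Fin using (Fin; toℕ)
open import Data.Bool using (Bool; true; false; _xor_; _∨_)
open import Data.Bool.Properties using (∨-comm)
open import Data.Product using (Σ; ∃; _×_; _,_; proj₁)
open import Relation.Binary.PropositionalEquality using (_≡_; refl; cong₂)
open import Relation.Nullary using (¬_)
open import Function.Bundles using (_↔_; _⇔_; Inverse)
open import Function.Definitions using (Injective)

record Graph (n : ℕ) : Set where
  field
    adj    : Fin n → Fin n → Bool
    sym    : ∀ u v → adj u v ≡ adj v u
    irrefl : ∀ u → adj u u ≡ false
open Graph public

module _ {n : ℕ} (G : Graph n) where

  data Walk : Fin n → Fin n → ℕ → Set where
    here : ∀ {u} → Walk u u 0
    step : ∀ {u w v k} → adj G u w ≡ true → Walk w v k → Walk u v (suc k)

  Connected : Set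
  Connected = ∀ u v → ∃ λ k → Walk u v k

  Dist : Fin n → Fin n → ℕ → Set
  Dist u v k = Walk u v k × (∀ m → m < k → ¬ Walk u v m)

  MaxDistantFrom : Fin n → Fin n → Set
  MaxDistantFrom u v =
    ∀ w → adj G u w ≡ true → ∀ a b → Dist v w a → Dist u v b → a ≤ b

  MMD : Fin n → Fin n → Set
  MMD u v = MaxDistantFrom u v × MaxDistantFrom v u

  InBoundary : Fin n → Set
  InBoundary u = ∃ λ v → MaxDistantFrom u v

_≅_ : ∀ {n} → Graph n → Graph n → Set
_≅_ {n} G H = Σ (Fin n ↔ Fin n) λ f →
  ∀ u v → adj G u v ≡ adj H (Inverse.to f u) (Inverse.to f v)

-- G_SR ≅ H, where H is a graph on Fin m: expressed as an isomorphism from H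
-- onto G_SR, i.e. an injective map f : Fin m → Fin n whose image is exactly
-- ∂(G), such that f i, f j are MMD in G iff i, j are adjacent in H.
SR≅ : ∀ {n m} → Graph n → Graph m → Set
SR≅ {n} {m} G H = Σ (Fin m → Fin n) λ f →
  Injective _≡_ _≡_ f
  × (∀ u → InBoundary G u ⇔ (∃ λ i → f i ≡ u))
  × (∀ i j → MMD G (f i) (f j) ⇔ (adj H i j ≡ true))

pathAdj : ∀ {n} → Fin n → Fin n → Bool
pathAdj i j = (suc (toℕ i) ≡ᵇ toℕ j) ∨ (suc (toℕ j) ≡ᵇ toℕ i)

private
  ≡ᵇ-suc-false : ∀ x → (suc x ≡ᵇ x) ≡ false
  ≡ᵇ-suc-false zero    = refl
  ≡ᵇ-suc-false (suc x) = ≡ᵇ-suc-false x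

  xor-self : ∀ b → (b xor b) ≡ false
  xor-self true  = refl
  xor-self false = refl

  xor-comm : ∀ a b → (a xor b) ≡ (b xor a)
  xor-comm true  true  = refl
  xor-comm true  false = refl
  xor-comm false true  = refl
  xor-comm false false = refl

P : (n : ℕ) → Graph n
P n = record
  { adj    = pathAdj
  ; sym    = λ u v → ∨-comm (suc (toℕ u) ≡ᵇ toℕ v) (suc (toℕ v) ≡ᵇ toℕ u)
  ; irrefl = λ u → cong₂ _∨_ (≡ᵇ-suc-false (toℕ u)) (≡ᵇ-suc-false (toℕ u))
  }

K : (s t : ℕ) → Graph (s + t)
K s t = record
  { adj    = λ i j → (toℕ i <ᵇ s) xor (toℕ j <ᵇ s)
  ; sym    = λ i j → xor-comm (toℕ i <ᵇ s) (toℕ j <ᵇ s)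
  ; irrefl = λ i → xor-self (toℕ i <ᵇ s)
  }

-- Walking away from v one step at a time (each step increases the distance from v) ends at a
-- vertex z maximally distant from v with d(v,z) = d(v,x) + d(x,z), where x is the start; and a
-- vertex maximally distant from x cannot lie strictly inside a geodesic ending at x.  Using this
-- twice, any two distinct vertices a, b yield a mutually maximally distant pair z, z′ such that
-- b is not maximally distant from z and a is not maximally distant from z′.  So in G_SR no two
-- vertices have a common neighbourhood meeting every edge; K_{2,r} and K_{1,r} (r ≥ 2) have such
-- pairs.  If ∂(G) = {a, b}, every vertex lies on an a–b geodesic and d(a,·) is injective, so
-- d(a,·) lays G out as a path; conversely the ends of a path are its only boundary vertices.

module Submission where

open import Defs hiding (sym)
open import Data.Nat using (ℕ; zero; suc; _+_; _≡ᵇ_; _∸_; _≤_; _<_; ∣_-_∣; z≤n; s≤s; s≤s⁻¹; _≤?_)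
open import Data.Nat.Properties
open import Data.Nat.Induction using (<-rec)
open import Data.Fin using (Fin; toℕ; fromℕ<) renaming (suc to fsuc)
open import Data.Fin.Patterns using (0F; 1F; 2F)
import Data.Fin.Properties as Fin
open import Data.Bool using (Bool; true; false; _∨_)
open import Data.Bool.Properties using () renaming (_≟_ to _≟ᵇ_)
open import Data.List using (map; allFin)
open import Data.List.Extrema.Nat using (max; xs≤max)
open import Data.List.Membership.Propositional.Properties using (∈-allFin)
import Data.List.Relation.Unary.All as All
open import Data.List.Relation.Unary.All.Properties using (map⁻)
open import Data.Product using (∃; ∃₂; _×_; _,_; proj₁; proj₂)
open import Data.Sum using (_⊎_; inj₁; inj₂; [_,_]′)
open import Data.Unit using (⊤; tt)
open import Data.Empty using (⊥; ⊥-elim)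
open import Function using (_∘_)
open import Function.Bundles using (_⇔_; _↔_; Inverse; Injection; Equivalence; mk⇔; mk↔ₛ′)
open import Function.Properties.Inverse using (↔⇒↣)
open import Function.Definitions using (Injective)
open import Function.Construct.Composition using (_⇔-∘_)
open import Function.Construct.Symmetry using (⇔-sym)
open import Relation.Binary.PropositionalEquality
  using (_≡_; _≢_; refl; sym; trans; cong; cong₂; subst; subst₂; module ≡-Reasoning)
open import Relation.Nullary using (¬_; Dec; yes; no; contradiction)
open import Relation.Nullary.Decidable using (_×-dec_; _→-dec_)

least : {P : ℕ → Set} → (∀ k → Dec (P k)) → ∀ {k} → P k →
        ∃ λ m → P m × (∀ j → j < m → ¬ P j)
least {P} P? {k} = <-rec (λ k → P k → ∃ λ m → P m × (∀ j → j < m → ¬ P j)) search k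
  where
  search : ∀ k → (∀ {j} → j < k → P j → ∃ λ m → P m × (∀ i → i < m → ¬ P i)) →
           P k → ∃ λ m → P m × (∀ j → j < m → ¬ P j)
  search k rec pk with anyUpTo? P? k
  ... | yes (j , j<k , pj) = rec j<k pj
  ... | no none            = k , pk , λ j j<k pj → none (j , j<k , pj)

module Distance {n : ℕ} (G : Graph n) (conn : Connected G) where

  adj-sym : ∀ {u v} → adj G u v ≡ true → adj G v u ≡ true
  adj-sym {u} {v} e = trans (Graph.sym G v u) e

  not-loop : ∀ {u v} → u ≡ v → adj G u v ≢ true
  not-loop {u} refl e = contradiction (trans (sym e) (Graph.irrefl G u)) λ ()

  _++ʷ_ : ∀ {u v x a b} → Walk G u v a → Walk G v x b → Walk G u x (a + b)
  here       ++ʷ q = q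
  step e p   ++ʷ q = step e (p ++ʷ q)

  reverseʷ : ∀ {u v k} → Walk G u v k → Walk G v u k
  reverseʷ here                 = here
  reverseʷ (step {k = k} e p) =
    subst (Walk G _ _) (+-comm k 1) (reverseʷ p ++ʷ step (adj-sym e) here)

  walk? : ∀ u v k → Dec (Walk G u v k)
  walk? u v zero with u Fin.≟ v
  ... | yes refl = yes here
  ... | no u≢v   = no λ { here → u≢v refl }
  walk? u v (suc k) with Fin.any? (λ w → (adj G u w ≟ᵇ true) ×-dec walk? w v k)
  ... | yes (w , e , p) = yes (step e p)
  ... | no none         = no λ { (step e p) → none (_ , e , p) }

  shortest : ∀ u v → ∃ λ k → Dist G u v k
  shortest u v = least (walk? u v) (proj₂ (conn u v))

  dist : Fin n → Fin n → ℕ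
  dist u v = proj₁ (shortest u v)

  dist-walk : ∀ u v → Walk G u v (dist u v)
  dist-walk u v = proj₁ (proj₂ (shortest u v))

  dist-minimal : ∀ {u v k} → Walk G u v k → dist u v ≤ k
  dist-minimal {u} {v} {k} p = ≮⇒≥ λ k<d → proj₂ (proj₂ (shortest u v)) k k<d p

  Dist⇒≡dist : ∀ {u v k} → Dist G u v k → k ≡ dist u v
  Dist⇒≡dist {u} {v} (p , minimal) = ≤-antisym
    (≮⇒≥ λ d<k → minimal (dist u v) d<k (dist-walk u v)) (dist-minimal p)

  dist-sym : ∀ u v → dist u v ≡ dist v u
  dist-sym u v = ≤-antisym (dist-minimal (reverseʷ (dist-walk v u)))
                           (dist-minimal (reverseʷ (dist-walk u v)))

  dist-refl : ∀ u → dist u u ≡ 0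
  dist-refl u = n≤0⇒n≡0 (dist-minimal (here {u = u}))

  dist≡0⇒≡ : ∀ {u v} → dist u v ≡ 0 → u ≡ v
  dist≡0⇒≡ {u} {v} e with subst (Walk G u v) e (dist-walk u v)
  ... | here = refl

  dist-triangle : ∀ u v x → dist u x ≤ dist u v + dist v x
  dist-triangle u v x = dist-minimal (dist-walk u v ++ʷ dist-walk v x)

  dist-adjacent : ∀ {u w} → adj G u w ≡ true → dist u w ≤ 1
  dist-adjacent e = dist-minimal (step e here)

  dist-step : ∀ {u w} v → adj G u w ≡ true → dist v w ≤ suc (dist v u)
  dist-step {u} {w} v e = begin
    dist v w             ≤⟨ dist-triangle v u w ⟩
    dist v u + dist u w  ≤⟨ +-monoʳ-≤ (dist v u) (dist-adjacent e) ⟩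
    dist v u + 1         ≡⟨ +-comm (dist v u) 1 ⟩
    suc (dist v u)       ∎
    where open ≤-Reasoning

  dist-reverse-triangle : ∀ a u v → ∣ dist a u - dist a v ∣ ≤ dist u v
  dist-reverse-triangle a u v with ∣m-n∣≡[m∸n]∨[n∸m] (dist a u) (dist a v)
  ... | inj₁ e = subst (_≤ dist u v) (sym e)
    (m≤n+o⇒m∸n≤o (dist a u) (dist a v)
      (≤-trans (dist-triangle a v u) (≤-reflexive (cong (dist a v +_) (dist-sym v u)))))
  ... | inj₂ e = subst (_≤ dist u v) (sym e)
    (m≤n+o⇒m∸n≤o (dist a v) (dist a u) (dist-triangle a u v))

  step-towards : ∀ u v {k} → dist u v ≡ suc k → ∃ λ w → adj G u w ≡ true × dist w v ≡ k
  step-towards u v {k} e with subst (Walk G u v) e (dist-walk u v)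
  ... | step {w = w} a p = w , a , ≤-antisym (dist-minimal p) (s≤s⁻¹ (begin
    suc k                ≡⟨ sym e ⟩
    dist u v             ≤⟨ dist-triangle u w v ⟩
    dist u w + dist w v  ≤⟨ +-monoˡ-≤ (dist w v) (dist-adjacent a) ⟩
    suc (dist w v)       ∎))
    where open ≤-Reasoning

  dist-intermediate : ∀ a x {m} → dist a x ≡ m → ∀ {k} → k ≤ m → ∃ λ y → dist a y ≡ k
  dist-intermediate a x e k≤m with m≤n⇒m<n∨m≡n k≤m
  dist-intermediate a x e k≤m | inj₂ refl = x , e
  dist-intermediate a x {suc m} e k≤m | inj₁ (s≤s k≤m′)
    with step-towards x a (trans (dist-sym x a) e)
  ... | w , _ , e′ = dist-intermediate a w (trans (dist-sym a w) e′) k≤m′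

  eccentricity : Fin n → ℕ
  eccentricity v = max 0 (map (dist v) (allFin n))

  dist≤eccentricity : ∀ v x → dist v x ≤ eccentricity v
  dist≤eccentricity v x = All.lookup (map⁻ (xs≤max 0 (map (dist v) (allFin n)))) (∈-allFin x)

  MaxDistant : Fin n → Fin n → Set
  MaxDistant u v = ∀ w → adj G u w ≡ true → dist v w ≤ dist u v

  maxDistant⇔ : ∀ u v → MaxDistantFrom G u v ⇔ MaxDistant u v
  maxDistant⇔ u v = mk⇔
    (λ h w e → h w e (dist v w) (dist u v) (proj₂ (shortest v w)) (proj₂ (shortest u v)))
    (λ h w e a b da db → subst₂ _≤_ (sym (Dist⇒≡dist da)) (sym (Dist⇒≡dist db)) (h w e))

  bounded? : ∀ u v w → Dec (adj G u w ≡ true → dist v w ≤ dist u v)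
  bounded? u v w = (adj G u w ≟ᵇ true) →-dec (dist v w ≤? dist u v)

  maxDistant? : ∀ u v → Dec (MaxDistant u v)
  maxDistant? u v = Fin.all? (bounded? u v)

  farther-neighbour : ∀ {x v} → ¬ MaxDistant x v →
                      ∃ λ w → adj G x w ≡ true × dist v w ≡ suc (dist v x)
  farther-neighbour {x} {v} ¬md with Fin.¬∀⟶∃¬ n _ (bounded? x v) ¬md
  ... | w , ¬bounded with adj G x w in e
  ...   | false = contradiction (λ ()) ¬bounded
  ...   | true  = w , e , ≤-antisym (dist-step v e)
                    (subst (_< dist v w) (dist-sym x v) (≰⇒> (¬bounded ∘ λ le _ → le)))

  module _ (v : Fin n) (I : Fin n → Set)
           (I-outward : ∀ {x w} → I x → adj G x w ≡ true → dist v w ≡ suc (dist v x) → I w)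
           where

    climb : ∀ fuel x → eccentricity v ≤ dist v x + fuel → I x →
            ∃ λ z → I z × MaxDistant z v × dist v z ≡ dist v x + dist x z
    climb fuel x bound ix with maxDistant? x v
    ... | yes md = x , ix , md , sym (trans (cong (dist v x +_) (dist-refl x)) (+-identityʳ _))
    ... | no ¬md with farther-neighbour ¬md
    climb zero x bound ix | no _ | w , _ , e =
      contradiction (≤-trans (dist≤eccentricity v w) (subst (eccentricity v ≤_) (+-identityʳ _) bound))
                    (<⇒≱ (≤-reflexive (sym e)))
    climb (suc fuel) x bound ix | no _ | w , a , e
      with climb fuel w (subst (eccentricity v ≤_) (trans (+-suc _ fuel) (cong (_+ fuel) (sym e))) bound)
                 (I-outward ix a e)
    ... | z , iz , md , ez = z , iz , md , ≤-antisym (dist-triangle v x z) (begin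
      dist v x + dist x z        ≡⟨ cong (dist v x +_) (dist-sym x z) ⟩
      dist v x + dist z x        ≤⟨ +-monoʳ-≤ (dist v x) (dist-step z (adj-sym a)) ⟩
      dist v x + suc (dist z w)  ≡⟨ +-suc (dist v x) (dist z w) ⟩
      suc (dist v x) + dist z w  ≡⟨ cong₂ _+_ (sym e) (dist-sym z w) ⟩
      dist v w + dist w z        ≡⟨ sym ez ⟩
      dist v z                   ∎)
      where open ≤-Reasoning

    climb-from : ∀ x → I x → ∃ λ z → I z × MaxDistant z v × dist v z ≡ dist v x + dist x z
    climb-from x = climb (eccentricity v) x (m≤n+m (eccentricity v) (dist v x))

  maxDistant-beyond : ∀ v x → ∃ λ z → MaxDistant z v × dist v z ≡ dist v x + dist x z
  maxDistant-beyond v x with climb-from v (λ _ → ⊤) (λ _ _ _ → tt) x tt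
  ... | z , _ , md , e = z , md , e

  mutuallyMaxDistant-beyond : ∀ {u v} → MaxDistant u v →
    ∃ λ z → MaxDistant z u × MaxDistant u z × dist u z ≡ dist u v + dist v z
  mutuallyMaxDistant-beyond {u} {v} md with climb-from u (MaxDistant u) outward v md
    where
    outward : ∀ {x w} → MaxDistant u x → adj G x w ≡ true → dist u w ≡ suc (dist u x) →
              MaxDistant u w
    outward {x} {w} mdx a e y ay = begin
      dist w y             ≤⟨ dist-triangle w x y ⟩
      dist w x + dist x y  ≤⟨ +-mono-≤ (dist-adjacent (adj-sym a)) (mdx y ay) ⟩
      suc (dist u x)       ≡⟨ sym e ⟩
      dist u w             ∎
      where open ≤-Reasoning
  ... | z , mduz , mdzu , e = z , mdzu , mduz , e

  maxDistant-not-interior : ∀ {a b x} → MaxDistant b x →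
                            dist a x ≡ dist a b + dist b x → a ≡ b
  maxDistant-not-interior {a} {b} {x} md e with dist b a in eba
  ... | zero  = sym (dist≡0⇒≡ eba)
  ... | suc k with step-towards b a eba
  ...   | w , bw , ewa = contradiction (begin-strict
      dist a x             ≤⟨ dist-triangle a w x ⟩
      dist a w + dist w x  ≡⟨ cong₂ _+_ (trans (dist-sym a w) ewa) (dist-sym w x) ⟩
      k + dist x w         ≤⟨ +-monoʳ-≤ k (md w bw) ⟩
      k + dist b x         <⟨ n<1+n _ ⟩
      suc k + dist b x     ≡⟨ cong (_+ dist b x) (trans (dist-sym a b) eba) ⟨
      dist a b + dist b x  ≡⟨ e ⟨
      dist a x             ∎) (n≮n (dist a x))
    where open ≤-Reasoning

  ¬maxDistant-self : ∀ {u v} → u ≢ v → ¬ MaxDistant u u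
  ¬maxDistant-self {u} {v} u≢v md with dist u v in e
  ... | zero  = u≢v (dist≡0⇒≡ e)
  ... | suc k with step-towards u v e
  ...   | w , uw , _ with dist≡0⇒≡ (n≤0⇒n≡0 (≤-trans (md w uw) (≤-reflexive (dist-refl u))))
  ...     | u≡w = not-loop u≡w uw

  mutuallyMaxDistant-avoiding : ∀ {a b} → a ≢ b →
    ∃₂ λ z z′ → MaxDistant z z′ × MaxDistant z′ z × ¬ MaxDistant b z × ¬ MaxDistant a z′
  mutuallyMaxDistant-avoiding {a} {b} a≢b with maxDistant-beyond a b
  ... | z , mdza , ez with mutuallyMaxDistant-beyond mdza
  ...   | z′ , mdz′z , mdzz′ , ez′ =
    z , z′ , mdzz′ , mdz′z ,
    (λ mdbz → a≢b (maxDistant-not-interior mdbz ez)) ,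
    (λ mdaz′ → ¬maxDistant-self a≢b
                 (subst (λ y → MaxDistant y a) (maxDistant-not-interior mdaz′ ez′) mdza))

module StrongResolvingIso {n m} {G : Graph n} (conn : Connected G) {H : Graph m} (sr : SR≅ G H) where
  open Distance G conn

  f : Fin m → Fin n
  f = proj₁ sr

  f-injective : Injective _≡_ _≡_ f
  f-injective = proj₁ (proj₂ sr)

  maxDistant⇒image : ∀ {z v} → MaxDistant z v → ∃ λ i → f i ≡ z
  maxDistant⇒image {z} {v} md =
    Equivalence.to (proj₁ (proj₂ (proj₂ sr)) z) (v , Equivalence.from (maxDistant⇔ z v) md)

  adjacent⇔MMD : ∀ i j → adj H i j ≡ true ⇔ (MaxDistant (f i) (f j) × MaxDistant (f j) (f i))
  adjacent⇔MMD i j = mk⇔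
    (λ e → let md₁ , md₂ = Equivalence.from (proj₂ (proj₂ (proj₂ sr)) i j) e
           in Equivalence.to (maxDistant⇔ (f i) (f j)) md₁ , Equivalence.to (maxDistant⇔ (f j) (f i)) md₂)
    (λ (md₁ , md₂) → Equivalence.to (proj₂ (proj₂ (proj₂ sr)) i j)
      (Equivalence.from (maxDistant⇔ (f i) (f j)) md₁ , Equivalence.from (maxDistant⇔ (f j) (f i)) md₂))

  MMD⇒edge : ∀ {z z′} → MaxDistant z z′ → MaxDistant z′ z →
             ∃₂ λ p q → f p ≡ z × f q ≡ z′ × adj H p q ≡ true
  MMD⇒edge mdzz′ mdz′z with maxDistant⇒image mdzz′ | maxDistant⇒image mdz′z
  ... | p , refl | q , refl = p , q , refl , refl , Equivalence.from (adjacent⇔MMD p q) (mdzz′ , mdz′z)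

CommonNeighbour : ∀ {m} → Graph m → Fin m → Fin m → Fin m → Set
CommonNeighbour H i j p = adj H p i ≡ true × adj H p j ≡ true

module _ {n m} {G : Graph n} (conn : Connected G) {H : Graph m} where
  open Distance G conn

  ¬SR≅-common-neighbourhood-cover : SR≅ G H → ∀ {i j} → i ≢ j →
    (∀ p q → adj H p q ≡ true → CommonNeighbour H i j p ⊎ CommonNeighbour H i j q) → ⊥
  ¬SR≅-common-neighbourhood-cover sr {i} {j} i≢j cover =
    let z , z′ , mdzz′ , mdz′z , ¬mdjz , ¬mdiz′ = mutuallyMaxDistant-avoiding (i≢j ∘ f-injective)
        p , q , fp≡z , fq≡z′ , pq = MMD⇒edge mdzz′ mdz′z
        maxDistant-from : ∀ {k y} → adj H y k ≡ true → MaxDistant (f k) (f y)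
        maxDistant-from {k} {y} e = proj₂ (Equivalence.to (adjacent⇔MMD y k) e)
    in [ (λ (_ , pj) → ¬mdjz (subst (MaxDistant (f j)) fp≡z (maxDistant-from pj)))
       , (λ (qi , _) → ¬mdiz′ (subst (MaxDistant (f i)) fq≡z′ (maxDistant-from qi)))
       ]′ (cover p q pq)
    where open StrongResolvingIso conn {H = H} sr

K₂-cover : ∀ r p q → adj (K 2 r) p q ≡ true →
           CommonNeighbour (K 2 r) 0F 1F p ⊎ CommonNeighbour (K 2 r) 0F 1F q
K₂-cover r 0F 0F ()
K₂-cover r 0F 1F ()
K₂-cover r 0F (fsuc (fsuc _)) _ = inj₂ (refl , refl)
K₂-cover r 1F 0F ()
K₂-cover r 1F 1F ()
K₂-cover r 1F (fsuc (fsuc _)) _ = inj₂ (refl , refl)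
K₂-cover r (fsuc (fsuc _)) q _ = inj₁ (refl , refl)

star-cover : ∀ r p q → adj (K 1 (2 + r)) p q ≡ true →
             CommonNeighbour (K 1 (2 + r)) 1F 2F p ⊎ CommonNeighbour (K 1 (2 + r)) 1F 2F q
star-cover r 0F 0F ()
star-cover r 0F (fsuc _) _ = inj₁ (refl , refl)
star-cover r (fsuc _) 0F _ = inj₂ (refl , refl)
star-cover r (fsuc _) (fsuc _) ()

successor-test⇔ : ∀ m k → ((suc m ≡ᵇ k) ∨ (suc k ≡ᵇ m)) ≡ true ⇔ ∣ m - k ∣ ≡ 1
successor-test⇔ zero           zero           = mk⇔ (λ ()) (λ ())
successor-test⇔ zero           (suc zero)     = mk⇔ (λ _ → refl) (λ _ → refl)
successor-test⇔ zero           (suc (suc k))  = mk⇔ (λ ()) (λ ())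
successor-test⇔ (suc zero)     zero           = mk⇔ (λ _ → refl) (λ _ → refl)
successor-test⇔ (suc (suc m))  zero           = mk⇔ (λ ()) (λ ())
successor-test⇔ (suc m)        (suc k)        = successor-test⇔ m k

pathAdj≡true⇔ : ∀ {n} (i j : Fin n) → pathAdj i j ≡ true ⇔ ∣ toℕ i - toℕ j ∣ ≡ 1
pathAdj≡true⇔ i j = successor-test⇔ (toℕ i) (toℕ j)

∣m-n∣≡1⇒ : ∀ {m k} → ∣ m - k ∣ ≡ 1 → suc m ≡ k ⊎ suc k ≡ m
∣m-n∣≡1⇒ {zero}     {suc zero} _ = inj₁ refl
∣m-n∣≡1⇒ {suc zero} {zero}     _ = inj₂ refl
∣m-n∣≡1⇒ {suc m}    {suc k}    e with ∣m-n∣≡1⇒ {m} {k} e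
... | inj₁ e′ = inj₁ (cong suc e′)
... | inj₂ e′ = inj₂ (cong suc e′)

≡true⇔⇒≡ : ∀ {b c : Bool} → b ≡ true ⇔ c ≡ true → b ≡ c
≡true⇔⇒≡ {true}          b⇔c = sym (Equivalence.to b⇔c refl)
≡true⇔⇒≡ {false} {true}  b⇔c = Equivalence.from b⇔c refl
≡true⇔⇒≡ {false} {false} _   = refl

module _ {n} (G : Graph n) (L : Fin n → ℕ) (D : ℕ)
         (L-injective : Injective _≡_ _≡_ L) (L≤D : ∀ x → L x ≤ D)
         (L-onto : ∀ {k} → k ≤ D → ∃ λ x → L x ≡ k)
         (adjacent⇔ : ∀ u v → adj G u v ≡ true ⇔ ∣ L u - L v ∣ ≡ 1) where

  n≡1+D : n ≡ suc D
  n≡1+D = Fin.cantor-schröder-bernstein {f = level} {g = vertexAt} level-injective vertexAt-injective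
    where
    level : Fin n → Fin (suc D)
    level x = fromℕ< (s≤s (L≤D x))
    level-injective : Injective _≡_ _≡_ level
    level-injective {x} {y} e = L-injective
      (trans (sym (Fin.toℕ-fromℕ< _)) (trans (cong toℕ e) (Fin.toℕ-fromℕ< _)))
    vertexAt : Fin (suc D) → Fin n
    vertexAt k = proj₁ (L-onto (s≤s⁻¹ (Fin.toℕ<n k)))
    vertexAt-injective : Injective _≡_ _≡_ vertexAt
    vertexAt-injective {k} {k′} e = Fin.toℕ-injective
      (trans (sym (proj₂ (L-onto _))) (trans (cong L e) (proj₂ (L-onto _))))

  ≅P-from-levels : G ≅ P n
  ≅P-from-levels = mk↔ₛ′ to from to∘from from∘to , λ u v →
    ≡true⇔⇒≡ (⇔-sym (pathAdj≡true⇔ (to u) (to v)) ⇔-∘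
      subst₂ (λ a b → adj G u v ≡ true ⇔ ∣ a - b ∣ ≡ 1)
             (sym (toℕ-to u)) (sym (toℕ-to v)) (adjacent⇔ u v))
    where
    to : Fin n → Fin n
    to x = fromℕ< (subst (L x <_) (sym n≡1+D) (s≤s (L≤D x)))
    toℕ-to : ∀ x → toℕ (to x) ≡ L x
    toℕ-to x = Fin.toℕ-fromℕ< _
    from-spec : ∀ k → ∃ λ x → L x ≡ toℕ k
    from-spec k = L-onto (s≤s⁻¹ (subst (toℕ k <_) n≡1+D (Fin.toℕ<n k)))
    from : Fin n → Fin n
    from k = proj₁ (from-spec k)
    to∘from : ∀ k → to (from k) ≡ k
    to∘from k = Fin.toℕ-injective (trans (toℕ-to (from k)) (proj₂ (from-spec k)))
    from∘to : ∀ x → from (to x) ≡ x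
    from∘to x = L-injective (trans (proj₂ (from-spec (to x))) (toℕ-to x))

module _ {n} {G : Graph n} (conn : Connected G) where
  open Distance G conn

  ≅P-if-boundary-pair : ∀ {a b} → a ≢ b → (∀ {z v} → MaxDistant z v → z ≡ a ⊎ z ≡ b) → G ≅ P n
  ≅P-if-boundary-pair {a} {b} a≢b boundary⊆ =
    ≅P-from-levels G (dist a) (dist a b) level-injective level≤ (dist-intermediate a b refl) adjacent⇔
    where
    on-geodesic : ∀ x → dist a x + dist x b ≡ dist a b
    on-geodesic x with maxDistant-beyond a x
    ... | z , md , e with boundary⊆ md
    ...   | inj₁ refl = contradiction md (¬maxDistant-self a≢b)
    ...   | inj₂ refl = sym e

    level≤ : ∀ x → dist a x ≤ dist a b
    level≤ x = subst (dist a x ≤_) (on-geodesic x) (m≤m+n (dist a x) (dist x b))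

    equidistant-endpoint : ∀ {x y z} → dist x z ≡ dist y z → dist x z ≡ dist x y + dist y z → x ≡ y
    equidistant-endpoint {x} {y} {z} eq e =
      dist≡0⇒≡ (+-cancelʳ-≡ (dist y z) (dist x y) 0 (sym (trans (sym eq) e)))

    level-injective : ∀ {x y} → dist a x ≡ dist a y → x ≡ y
    level-injective {x} {y} e with maxDistant-beyond x y
    ... | z , md , ez with boundary⊆ md
    ...   | inj₁ refl = equidistant-endpoint (trans (dist-sym x a) (trans e (dist-sym a y))) ez
    ...   | inj₂ refl = equidistant-endpoint (+-cancelˡ-≡ (dist a x) _ _ (begin
      dist a x + dist x b  ≡⟨ on-geodesic x ⟩
      dist a b             ≡⟨ on-geodesic y ⟨
      dist a y + dist y b  ≡⟨ cong (_+ dist y b) e ⟨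
      dist a x + dist y b  ∎)) ez
      where open ≡-Reasoning

    adjacent-of-next-level : ∀ {u v} → suc (dist a u) ≡ dist a v → adj G u v ≡ true
    adjacent-of-next-level {u} {v} e with step-towards v a (trans (dist-sym v a) (sym e))
    ... | w , vw , ewa with level-injective {w} {u} (trans (dist-sym a w) ewa)
    ...   | refl = adj-sym vw

    adjacent⇔ : ∀ u v → adj G u v ≡ true ⇔ ∣ dist a u - dist a v ∣ ≡ 1
    adjacent⇔ u v = mk⇔ adjacent⇒ ⇒adjacent
      where
      adjacent⇒ : adj G u v ≡ true → ∣ dist a u - dist a v ∣ ≡ 1
      adjacent⇒ e with ∣ dist a u - dist a v ∣ in gap
      ... | zero        = contradiction e (not-loop (level-injective (∣m-n∣≡0⇒m≡n gap)))
      ... | suc zero    = refl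
      ... | suc (suc k) = contradiction (begin
        suc (suc k)              ≡⟨ gap ⟨
        ∣ dist a u - dist a v ∣  ≤⟨ dist-reverse-triangle a u v ⟩
        dist u v                 ≤⟨ dist-adjacent e ⟩
        1                        ∎) λ { (s≤s ()) }
        where open ≤-Reasoning
      ⇒adjacent : ∣ dist a u - dist a v ∣ ≡ 1 → adj G u v ≡ true
      ⇒adjacent gap with ∣m-n∣≡1⇒ gap
      ... | inj₁ e = adjacent-of-next-level e
      ... | inj₂ e = adj-sym (adjacent-of-next-level e)

  SR≅K₁₁⇒boundary-pair : SR≅ G (K 1 1) →
    ∃₂ λ a b → a ≢ b × (∀ {z v} → MaxDistant z v → z ≡ a ⊎ z ≡ b)
  SR≅K₁₁⇒boundary-pair sr = f 0F , f 1F , (λ e → contradiction (f-injective e) λ ()) , boundary⊆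
    where
    open StrongResolvingIso conn {H = K 1 1} sr
    boundary⊆ : ∀ {z v} → MaxDistant z v → z ≡ f 0F ⊎ z ≡ f 1F
    boundary⊆ md with maxDistant⇒image md
    ... | 0F , refl = inj₁ refl
    ... | 1F , refl = inj₂ refl

  boundary-pair⇒SR≅K₁₁ : ∀ {a b} → a ≢ b → MaxDistant a b → MaxDistant b a →
    (∀ {z v} → MaxDistant z v → z ≡ a ⊎ z ≡ b) → SR≅ G (K 1 1)
  boundary-pair⇒SR≅K₁₁ {a} {b} a≢b mdab mdba boundary⊆ = f , f-injective , boundary , mmd
    where
    f : Fin 2 → Fin n
    f 0F = a
    f 1F = b
    f-injective : Injective _≡_ _≡_ f
    f-injective {0F} {0F} _ = refl
    f-injective {0F} {1F} e = contradiction e a≢b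
    f-injective {1F} {0F} e = contradiction (sym e) a≢b
    f-injective {1F} {1F} _ = refl
    boundary : ∀ u → InBoundary G u ⇔ (∃ λ i → f i ≡ u)
    boundary u = mk⇔
      (λ (v , md) → [ (λ u≡a → 0F , sym u≡a) , (λ u≡b → 1F , sym u≡b) ]′
                      (boundary⊆ (Equivalence.to (maxDistant⇔ u v) md)))
      λ { (0F , refl) → b , Equivalence.from (maxDistant⇔ a b) mdab
        ; (1F , refl) → a , Equivalence.from (maxDistant⇔ b a) mdba }
    ¬MMD-self : ∀ {x y} → x ≢ y → ¬ MMD G x x
    ¬MMD-self {x} x≢y (md , _) = ¬maxDistant-self x≢y (Equivalence.to (maxDistant⇔ x x) md)
    mmd : ∀ i j → MMD G (f i) (f j) ⇔ (adj (K 1 1) i j ≡ true)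
    mmd 0F 0F = mk⇔ (⊥-elim ∘ ¬MMD-self a≢b) λ ()
    mmd 0F 1F = mk⇔ (λ _ → refl)
      λ _ → Equivalence.from (maxDistant⇔ a b) mdab , Equivalence.from (maxDistant⇔ b a) mdba
    mmd 1F 0F = mk⇔ (λ _ → refl)
      λ _ → Equivalence.from (maxDistant⇔ b a) mdba , Equivalence.from (maxDistant⇔ a b) mdab
    mmd 1F 1F = mk⇔ (⊥-elim ∘ ¬MMD-self (a≢b ∘ sym)) λ ()

∣m-1+m∣≡1 : ∀ m → ∣ m - suc m ∣ ≡ 1
∣m-1+m∣≡1 zero    = refl
∣m-1+m∣≡1 (suc m) = ∣m-1+m∣≡1 m

middle-not-farthest : ∀ a b → ∣ a - b ∣ ≤ ∣ a - suc b ∣ → ∣ a - suc (suc b) ∣ ≤ ∣ a - suc b ∣ → ⊥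
middle-not-farthest zero    b       _ right = 1+n≰n right
middle-not-farthest (suc a) zero    left _  = 1+n≰n (subst (suc a ≤_) (∣-∣-identityʳ a) left)
middle-not-farthest (suc a) (suc b) left right = middle-not-farthest a b left right

module PathLabelled {n} {G : Graph n} (conn : Connected G) (φ : Fin n ↔ Fin n)
       (iso : ∀ u v → adj G u v ≡ pathAdj (Inverse.to φ u) (Inverse.to φ v)) where
  open Distance G conn

  label : Fin n → ℕ
  label u = toℕ (Inverse.to φ u)

  label-injective : ∀ {u v} → label u ≡ label v → u ≡ v
  label-injective e = Injection.injective (↔⇒↣ φ) (Fin.toℕ-injective e)

  vertexAt : ∀ k → k < n → Fin n
  vertexAt k k<n = Inverse.from φ (fromℕ< k<n)

  label-vertexAt : ∀ k (k<n : k < n) → label (vertexAt k k<n) ≡ k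
  label-vertexAt k k<n = trans (cong toℕ (Inverse.strictlyInverseˡ φ _)) (Fin.toℕ-fromℕ< k<n)

  adjacent⇔ : ∀ u v → adj G u v ≡ true ⇔ ∣ label u - label v ∣ ≡ 1
  adjacent⇔ u v = subst (λ b → b ≡ true ⇔ ∣ label u - label v ∣ ≡ 1)
                        (sym (iso u v)) (pathAdj≡true⇔ (Inverse.to φ u) (Inverse.to φ v))

  walk-length≥gap : ∀ {u v k} → Walk G u v k → ∣ label u - label v ∣ ≤ k
  walk-length≥gap {u} here = ≤-reflexive (∣n-n∣≡0 (label u))
  walk-length≥gap {u} {v} {suc k} (step {w = w} e p) = begin
    ∣ label u - label v ∣                          ≤⟨ ∣-∣-triangle (label u) (label w) (label v) ⟩
    ∣ label u - label w ∣ + ∣ label w - label v ∣  ≤⟨ +-mono-≤ u~w (walk-length≥gap p) ⟩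
    1 + k                                          ∎
    where
    open ≤-Reasoning
    u~w : ∣ label u - label w ∣ ≤ 1
    u~w = ≤-reflexive (Equivalence.to (adjacent⇔ u w) e)

  upward-walk : ∀ d {u v} → label u + d ≡ label v → Walk G u v d
  upward-walk zero {u} e with label-injective (trans (sym (+-identityʳ (label u))) e)
  ... | refl = here
  upward-walk (suc d) {u} {v} e = step (Equivalence.from (adjacent⇔ u w) gap) (upward-walk d e′)
    where
    next<n : suc (label u) < n
    next<n = <-≤-trans (s≤s (subst (suc (label u) ≤_) (trans (sym (+-suc (label u) d)) e)
                                   (m≤m+n (suc (label u)) d)))
                       (Fin.toℕ<n (Inverse.to φ v))
    w : Fin n
    w = vertexAt (suc (label u)) next<n
    gap : ∣ label u - label w ∣ ≡ 1
    gap = trans (cong (∣ label u -_∣) (label-vertexAt _ next<n)) (∣m-1+m∣≡1 (label u))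
    e′ : label w + d ≡ label v
    e′ = trans (cong (_+ d) (label-vertexAt _ next<n)) (trans (sym (+-suc (label u) d)) e)

  dist-gap : ∀ u v → dist u v ≡ ∣ label u - label v ∣
  dist-gap u v = ≤-antisym shortcut (walk-length≥gap (dist-walk u v))
    where
    shortcut : dist u v ≤ ∣ label u - label v ∣
    shortcut with label u ≤? label v
    ... | yes le = subst (dist u v ≤_) (sym (m≤n⇒∣m-n∣≡n∸m le))
                     (dist-minimal (upward-walk _ (m+[n∸m]≡n le)))
    ... | no ¬le = subst (dist u v ≤_) (sym (m≤n⇒∣n-m∣≡n∸m (≰⇒≥ ¬le)))
                     (dist-minimal (reverseʷ (upward-walk _ (m+[n∸m]≡n (≰⇒≥ ¬le)))))

  maxDistant⇒end : ∀ {u v} → MaxDistant u v → label u ≡ 0 ⊎ suc (label u) ≡ n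
  maxDistant⇒end {u} {v} md with label u in e
  ... | zero  = inj₁ refl
  ... | suc b with m≤n⇒m<n∨m≡n (subst (_< n) e (Fin.toℕ<n (Inverse.to φ u)))
  ...   | inj₂ e′ = inj₂ e′
  ...   | inj₁ b+2<n = ⊥-elim (middle-not-farthest (label v) b
            (neighbour-bound b<n (trans (∣-∣-comm (suc b) b) (∣m-1+m∣≡1 b)))
            (neighbour-bound b+2<n (∣m-1+m∣≡1 b)))
    where
    b<n : b < n
    b<n = <-trans (n<1+n b) (<-trans (n<1+n (suc b)) b+2<n)
    neighbour-bound : ∀ {k} (k<n : k < n) → ∣ suc b - k ∣ ≡ 1 → ∣ label v - k ∣ ≤ ∣ label v - suc b ∣
    neighbour-bound {k} k<n gap = begin
      ∣ label v - k ∣        ≡⟨ cong (∣ label v -_∣) (sym (label-vertexAt k k<n)) ⟩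
      ∣ label v - label w ∣  ≡⟨ sym (dist-gap v w) ⟩
      dist v w               ≤⟨ md w (Equivalence.from (adjacent⇔ u w) u~w) ⟩
      dist u v               ≡⟨ dist-gap u v ⟩
      ∣ label u - label v ∣  ≡⟨ cong (∣_- label v ∣) e ⟩
      ∣ suc b - label v ∣    ≡⟨ ∣-∣-comm (suc b) (label v) ⟩
      ∣ label v - suc b ∣    ∎
      where
      open ≤-Reasoning
      w : Fin n
      w = vertexAt k k<n
      u~w : ∣ label u - label w ∣ ≡ 1
      u~w = subst₂ (λ x y → ∣ x - y ∣ ≡ 1) (sym e) (sym (label-vertexAt k k<n)) gap

  ends-mutuallyMaxDistant : ∀ {a b} → label a ≡ 0 → suc (label b) ≡ n →
                            MaxDistant a b × MaxDistant b a
  ends-mutuallyMaxDistant {a} {b} first last = (λ w _ → begin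
      dist b w               ≡⟨ dist-gap b w ⟩
      ∣ label b - label w ∣  ≡⟨ m≤n⇒∣n-m∣≡n∸m (below-last w) ⟩
      label b ∸ label w      ≤⟨ m∸n≤m (label b) (label w) ⟩
      label b                ≡⟨ sym (from-first b) ⟩
      dist a b               ∎)
    , (λ w _ → begin
      dist a w               ≡⟨ from-first w ⟩
      label w                ≤⟨ below-last w ⟩
      label b                ≡⟨ sym (from-first b) ⟩
      dist a b               ≡⟨ dist-sym a b ⟩
      dist b a               ∎)
    where
    open ≤-Reasoning
    from-first : ∀ w → dist a w ≡ label w
    from-first w = trans (dist-gap a w) (cong (∣_- label w ∣) first)
    below-last : ∀ w → label w ≤ label b
    below-last w = s≤s⁻¹ (subst (label w <_) (sym last) (Fin.toℕ<n (Inverse.to φ w)))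

path⇒SR≅K₁₁ : ∀ {n} {G : Graph (2 + n)} → Connected G → G ≅ P (2 + n) → SR≅ G (K 1 1)
path⇒SR≅K₁₁ {n} {G} conn (φ , iso) =
  boundary-pair⇒SR≅K₁₁ conn first≢last (proj₁ ends-MMD) (proj₂ ends-MMD) boundary⊆
  where
  open Distance G conn
  open PathLabelled conn φ iso
  first last : Fin (2 + n)
  first = vertexAt 0 (s≤s z≤n)
  last  = vertexAt (suc n) ≤-refl
  label-first : label first ≡ 0
  label-first = label-vertexAt 0 (s≤s z≤n)
  label-last : suc (label last) ≡ 2 + n
  label-last = cong suc (label-vertexAt (suc n) ≤-refl)
  first≢last : first ≢ last
  first≢last e = 0≢1+n (trans (sym label-first) (suc-injective (trans (cong (suc ∘ label) e) label-last)))
  ends-MMD : MaxDistant first last × MaxDistant last first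
  ends-MMD = ends-mutuallyMaxDistant label-first label-last
  boundary⊆ : ∀ {z v} → MaxDistant z v → z ≡ first ⊎ z ≡ last
  boundary⊆ md with maxDistant⇒end md
  ... | inj₁ e = inj₁ (label-injective (trans e (sym label-first)))
  ... | inj₂ e = inj₂ (label-injective (suc-injective (trans e (sym label-last))))

proposition16 : (n : ℕ) → 2 ≤ n → (G : Graph n) → Connected G →
    (r : ℕ) → 1 ≤ r →
    (SR≅ G (K 1 r) ⇔ (G ≅ P n × r ≡ 1)) × ¬ SR≅ G (K 2 r)
proposition16 (suc (suc n)) (s≤s (s≤s z≤n)) G conn r 1≤r =
  mk⇔ (star⇒path r 1≤r)
      (λ (G≅P , r≡1) → subst (λ r → SR≅ G (K 1 r)) (sym r≡1) (path⇒SR≅K₁₁ conn G≅P)) ,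
  λ sr → ¬SR≅-common-neighbourhood-cover conn {H = K 2 r} sr {0F} {1F} (λ ()) (K₂-cover r)
  where
  star⇒path : ∀ r → 1 ≤ r → SR≅ G (K 1 r) → G ≅ P (2 + n) × r ≡ 1
  star⇒path 1 _ sr =
    let a , b , a≢b , boundary⊆ = SR≅K₁₁⇒boundary-pair conn sr
    in ≅P-if-boundary-pair conn a≢b boundary⊆ , refl
  star⇒path (suc (suc r)) _ sr =
    ⊥-elim (¬SR≅-common-neighbourhood-cover conn {H = K 1 (2 + r)} sr {1F} {2F} (λ ()) (star-cover r))
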